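{- Let $s$ be a positive integer and let $F$ be a non-empty finite subset of $\mathbb{Z}^s$. Define $E=F\cap(F-\mathbf{e}_1)\cap\cdots\cap(F-\mathbf{e}_s)$, where $(\mathbf{e}_1,\dots,\mathbf{e}_s)$ is the canonical basis of $\mathbb{Z}^s$. Then $|E|\le|F|-|F|^{(s-1)/s}$. -}

module Defs where

open import Data.Nat using (ℕ; suc)
open import Data.Integer using (ℤ; _+_; +_)
open import Data.Fin using (Fin)
open import Data.Vec using (Vec; tabulate; zipWith)
open import Data.Vec.Properties using (≡-dec)
open import Data.List using (List; filter)
open import Data.Fin.Properties using (all?)
open import Data.Integer.Properties using () renaming (_≟_ to _≟ℤ_)
open import Relation.Binary.PropositionalEquality using (_≡_)
open import Relation.Binary.Definitions using (DecidableEquality)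
open import Relation.Nullary using (Dec; yes; no)
open import Data.Bool using (if_then_else_)
import Data.List.Membership.DecPropositional as DecMem

Point : ℕ → Set
Point s = Vec ℤ s

_≟P_ : ∀ {s} → DecidableEquality (Point s)
_≟P_ = ≡-dec _≟ℤ_

e : ∀ {s} → Fin s → Point s
e i = tabulate (λ j → if Data.Fin._≟_ i j .Dec.does then + 1 else + 0)
  where import Data.Fin

_⊕_ : ∀ {s} → Point s → Point s → Point s
_⊕_ = zipWith _+_

module _ {s : ℕ} where
  open DecMem (_≟P_ {s}) using (_∈_; _∈?_) public

InE : ∀ {s} → List (Point s) → Point s → Set
InE {s} F x = (x ∈ F) Data.Product.× (∀ (i : Fin s) → (x ⊕ e i) ∈ F)
  where import Data.Product

inE? : ∀ {s} (F : List (Point s)) (x : Point s) → Dec (InE F x)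
inE? F x = (x ∈? F) ×-dec all? (λ i → (x ⊕ e i) ∈? F)
  where open import Relation.Nullary.Decidable using (_×-dec_)

-- E = F ∩ (F - e_1) ∩ ... ∩ (F - e_s), as a sublist of the duplicate-free list F
E : ∀ {s} → List (Point s) → List (Point s)
E F = filter (inE? F) F

-- Write B = F ∖ E for the points of F that leave F in some coordinate direction; the claim is
-- |F|^(s-1) ≤ |B|^s. Induct on s, slicing F along the first coordinate into slices F_k ⊆ ℤ^(s-1).
-- The topmost point of F on each line parallel to e₁ lies in B, so |F_k| ≤ |B|; and the boundaries
-- B_k of the slices lie disjointly in B. The induction hypothesis |F_k|^(s-2) ≤ |B_k|^(s-1) then
-- gives |F_k| ≤ |B|^(1/(s-1)) |B_k|, and summing over k yields |F| ≤ |B|^(1/(s-1)) |B|.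
module Submission where

open import Defs hiding (_∈_)
open import Data.Nat using (ℕ; zero; suc; _+_; _*_; _∸_; _^_; _≤_; z≤n; s≤s)
open import Data.Nat.Properties
open import Data.Nat.ListAction using (sum)
open import Algebra.Properties.CommutativeSemigroup *-commutativeSemigroup using (interchange)
open import Data.Integer as ℤ using (ℤ)
import Data.Integer.Properties as ℤ
open import Data.Fin using (zero; suc)
open import Data.Vec using ([]; _∷_; head; tail; tabulate)
open import Data.Vec.Properties using (∷-injectiveʳ)
open import Data.List using (List; []; _∷_; _++_; map; filter; length; deduplicate)
open import Data.List.Properties using (length-map; length-++; length-++-sucʳ; length-filter)
open import Data.List.Relation.Unary.Any using (here; there)
open import Data.List.Relation.Unary.All as All using ()
open import Data.List.Relation.Unary.Unique.Propositional using (Unique; []; _∷_)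
import Data.List.Relation.Unary.Unique.Propositional.Properties as Unique
open import Data.List.Relation.Unary.Unique.DecPropositional.Properties using (deduplicate-!)
open import Data.List.Membership.Propositional using (_∈_; _∉_)
open import Data.List.Membership.Propositional.Properties
  using (∈-map⁺; ∈-map⁻; ∈-filter⁺; ∈-filter⁻; ∈-++⁺ˡ; ∈-++⁺ʳ; ∈-++⁻; ∈-∃++; ∈-deduplicate⁺)
open import Data.List.Relation.Binary.Subset.Propositional using (_⊆_)
open import Data.List.Extrema ℤ.≤-totalOrder using (max; argmax-sel; xs≤max)
open import Data.Product using (∃; _×_; _,_; proj₁; proj₂; map₁)
open import Data.Sum using (inj₁; inj₂)
open import Function using (id)
open import Relation.Nullary using (¬_; yes; no; contradiction)
open import Relation.Unary using (Decidable)
open import Relation.Unary.Properties using (∁?)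
open import Relation.Binary.PropositionalEquality

^-distribʳ-* : ∀ m n p → (m * n) ^ p ≡ m ^ p * n ^ p
^-distribʳ-* m n zero = refl
^-distribʳ-* m n (suc p) = begin
  m * n * (m * n) ^ p       ≡⟨ cong (m * n *_) (^-distribʳ-* m n p) ⟩
  m * n * (m ^ p * n ^ p)   ≡⟨ interchange m n (m ^ p) (n ^ p) ⟩
  m * m ^ p * (n * n ^ p)   ∎
  where open ≡-Reasoning

-- a ≤ m^(1/p) * c, stated without roots
PowBounded : (m p a c : ℕ) → Set
PowBounded m p a c = a ^ p ≤ m * c ^ p

mediant-≤ : ∀ a b c d → a * d ≤ b * c → (a + b) * d ≤ b * (c + d)
mediant-≤ a b c d ad≤bc = begin
  (a + b) * d   ≡⟨ *-distribʳ-+ d a b ⟩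
  a * d + b * d ≤⟨ +-monoˡ-≤ (b * d) ad≤bc ⟩
  b * c + b * d ≡⟨ *-distribˡ-+ b c d ⟨
  b * (c + d)   ∎
  where open ≤-Reasoning

powBounded-mediant : ∀ m p a b c d → PowBounded m (suc p) a c → PowBounded m (suc p) b d →
                     a * d ≤ b * c → PowBounded m (suc p) (a + b) (c + d)
powBounded-mediant m p a b c zero ha hb _ =
  subst₂ (PowBounded m (suc p)) (sym a+b≡a) (sym (+-identityʳ c)) ha
  where
  b≡0 : b ≡ 0
  b≡0 = m^n≡0⇒m≡0 b (suc p) (n≤0⇒n≡0 (≤-trans hb (≤-reflexive (*-zeroʳ m))))
  a+b≡a : a + b ≡ a
  a+b≡a = trans (cong (a +_) b≡0) (+-identityʳ a)
powBounded-mediant m p a b c d@(suc _) ha hb ad≤bc = *-cancelˡ-≤ (d ^ q) {{m^n≢0 d q}} (begin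
  d ^ q * (a + b) ^ q     ≡⟨ trans (^-distribʳ-* (a + b) d q) (*-comm ((a + b) ^ q) (d ^ q)) ⟨
  ((a + b) * d) ^ q       ≤⟨ ^-monoˡ-≤ q (mediant-≤ a b c d ad≤bc) ⟩
  (b * (c + d)) ^ q       ≡⟨ ^-distribʳ-* b (c + d) q ⟩
  b ^ q * (c + d) ^ q     ≤⟨ *-monoˡ-≤ ((c + d) ^ q) hb ⟩
  m * d ^ q * (c + d) ^ q ≡⟨ cong (_* (c + d) ^ q) (*-comm m (d ^ q)) ⟩
  d ^ q * m * (c + d) ^ q ≡⟨ *-assoc (d ^ q) m _ ⟩
  d ^ q * (m * (c + d) ^ q) ∎)
  where
  q = suc p
  open ≤-Reasoning

powBounded-+ : ∀ m p a b c d → PowBounded m (suc p) a c → PowBounded m (suc p) b d →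
               PowBounded m (suc p) (a + b) (c + d)
powBounded-+ m p a b c d ha hb with ≤-total (a * d) (b * c)
... | inj₁ ad≤bc = powBounded-mediant m p a b c d ha hb ad≤bc
... | inj₂ bc≤ad = subst₂ (PowBounded m (suc p)) (+-comm b a) (+-comm d c)
                     (powBounded-mediant m p b a d c hb ha bc≤ad)

powBounded-sum : ∀ {A : Set} m p (f g : A → ℕ) → (∀ x → PowBounded m (suc p) (f x) (g x)) →
                 ∀ xs → PowBounded m (suc p) (sum (map f xs)) (sum (map g xs))
powBounded-sum m p f g fg [] = z≤n
powBounded-sum m p f g fg (x ∷ xs) =
  powBounded-+ m p (f x) (sum (map f xs)) (g x) (sum (map g xs)) (fg x) (powBounded-sum m p f g fg xs)

unique∧⊆⇒length≤ : ∀ {A : Set} {xs ys : List A} → Unique xs → xs ⊆ ys → length xs ≤ length ys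
unique∧⊆⇒length≤ [] _ = z≤n
unique∧⊆⇒length≤ {xs = x ∷ xs} (x∉xs ∷ uxs) xxs⊆ys with ∈-∃++ (xxs⊆ys (here refl))
... | us , vs , refl = begin
  suc (length xs)         ≤⟨ s≤s (unique∧⊆⇒length≤ uxs xs⊆us++vs) ⟩
  suc (length (us ++ vs)) ≡⟨ length-++-sucʳ us x vs ⟨
  length (us ++ x ∷ vs)   ∎
  where
  open ≤-Reasoning
  xs⊆us++vs : xs ⊆ us ++ vs
  xs⊆us++vs {z} z∈xs with ∈-++⁻ us (xxs⊆ys (there z∈xs))
  ... | inj₁ z∈us = ∈-++⁺ˡ z∈us
  ... | inj₂ (here refl) = contradiction refl (All.lookup x∉xs z∈xs)
  ... | inj₂ (there z∈vs) = ∈-++⁺ʳ us z∈vs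

length-filter+filter-∁ : ∀ {A : Set} {P : A → Set} (P? : Decidable P) xs →
                         length (filter P? xs) + length (filter (∁? P?) xs) ≡ length xs
length-filter+filter-∁ P? [] = refl
length-filter+filter-∁ P? (x ∷ xs) with P? x
... | yes _ = cong suc (length-filter+filter-∁ P? xs)
... | no _ = trans (+-suc _ _) (cong suc (length-filter+filter-∁ P? xs))

boundary : ∀ {s} → List (Point s) → List (Point s)
boundary F = filter (∁? (inE? F)) F

∈-boundary⁺ : ∀ {s} {F : List (Point s)} {x} i → x ∈ F → (x ⊕ e i) ∉ F → x ∈ boundary F
∈-boundary⁺ i x∈F x+ei∉F = ∈-filter⁺ (∁? (inE? _)) x∈F (λ (_ , x+e∈F) → x+ei∉F (x+e∈F i))

∈-boundary⁻ : ∀ {s} (F : List (Point s)) {x} → x ∈ boundary F → x ∈ F × ¬ InE F x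
∈-boundary⁻ F = ∈-filter⁻ (∁? (inE? F))

length-boundary : ∀ {s} (F : List (Point s)) → length (boundary F) ≡ length F ∸ length (E F)
length-boundary F = trans (sym (m+n∸m≡n (length (E F)) _))
                          (cong (_∸ length (E F)) (length-filter+filter-∁ (inE? F) F))

⊕-identityʳ : ∀ {n} (y : Point n) → y ⊕ tabulate (λ _ → ℤ.+ 0) ≡ y
⊕-identityʳ [] = refl
⊕-identityʳ (k ∷ y) = cong₂ _∷_ (ℤ.+-identityʳ k) (⊕-identityʳ y)

∷-⊕-e-zero : ∀ {n} k (y : Point n) → (k ∷ y) ⊕ e zero ≡ ℤ.suc k ∷ y
∷-⊕-e-zero k y = cong₂ _∷_ (ℤ.+-comm k (ℤ.+ 1)) (⊕-identityʳ y)

∷-⊕-e-suc : ∀ {n} k (y : Point n) j → (k ∷ y) ⊕ e (suc j) ≡ k ∷ (y ⊕ e j)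
∷-⊕-e-suc k y j = cong (_∷ y ⊕ e j) (ℤ.+-identityʳ k)

slice : ∀ {n} → ℤ → List (Point (suc n)) → List (Point n)
slice k [] = []
slice k ((j ∷ y) ∷ F) with j ℤ.≟ k
... | yes _ = y ∷ slice k F
... | no _ = slice k F

∈-slice⁺ : ∀ {n} {k} {y : Point n} {F} → (k ∷ y) ∈ F → y ∈ slice k F
∈-slice⁺ {k = k} {F = (j ∷ z) ∷ F} k∷y∈F with j ℤ.≟ k | k∷y∈F
... | yes _ | here refl = here refl
... | yes _ | there k∷y∈F = there (∈-slice⁺ k∷y∈F)
... | no j≢k | here refl = contradiction refl j≢k
... | no _ | there k∷y∈F = ∈-slice⁺ k∷y∈F

∈-slice⁻ : ∀ {n} k (F : List (Point (suc n))) {y} → y ∈ slice k F → (k ∷ y) ∈ F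
∈-slice⁻ k ((j ∷ z) ∷ F) y∈slice with j ℤ.≟ k | y∈slice
... | yes refl | here refl = here refl
... | yes _ | there y∈slice = there (∈-slice⁻ k F y∈slice)
... | no _ | y∈slice = there (∈-slice⁻ k F y∈slice)

slice-unique : ∀ {n} k {F : List (Point (suc n))} → Unique F → Unique (slice k F)
slice-unique k {[]} [] = []
slice-unique k {(j ∷ y) ∷ F} (j∷y∉F ∷ uF) with j ℤ.≟ k
... | yes refl = y∉slice ∷ slice-unique k uF
  where
  y∉slice : All.All (y ≢_) (slice j F)
  y∉slice = All.tabulate (λ z∈slice y≡z → All.lookup j∷y∉F (∈-slice⁻ j F z∈slice) (cong (j ∷_) y≡z))
... | no _ = slice-unique k uF

stack : ∀ {n} → List ℤ → (ℤ → List (Point n)) → List (Point (suc n))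
stack [] G = []
stack (k ∷ K) G = map (k ∷_) (G k) ++ stack K G

length-stack : ∀ {n} K (G : ℤ → List (Point n)) →
               length (stack K G) ≡ sum (map (λ k → length (G k)) K)
length-stack [] G = refl
length-stack (k ∷ K) G = begin
  length (map (k ∷_) (G k) ++ stack K G)         ≡⟨ length-++ (map (k ∷_) (G k)) ⟩
  length (map (k ∷_) (G k)) + length (stack K G) ≡⟨ cong₂ _+_ (length-map (k ∷_) (G k)) (length-stack K G) ⟩
  length (G k) + sum (map (λ k → length (G k)) K) ∎
  where open ≡-Reasoning

∈-stack⁺ : ∀ {n} {K} {G : ℤ → List (Point n)} {k y} → k ∈ K → y ∈ G k → (k ∷ y) ∈ stack K G
∈-stack⁺ {K = k ∷ K} (here refl) y∈Gk = ∈-++⁺ˡ (∈-map⁺ (k ∷_) y∈Gk)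
∈-stack⁺ {K = j ∷ K} {G} (there k∈K) y∈Gk = ∈-++⁺ʳ (map (j ∷_) (G j)) (∈-stack⁺ k∈K y∈Gk)

∈-stack⁻ : ∀ {n} K (G : ℤ → List (Point n)) {k y} → (k ∷ y) ∈ stack K G → k ∈ K × y ∈ G k
∈-stack⁻ (j ∷ K) G k∷y∈stack with ∈-++⁻ (map (j ∷_) (G j)) k∷y∈stack
... | inj₂ k∷y∈rest = map₁ there (∈-stack⁻ K G k∷y∈rest)
... | inj₁ k∷y∈layer with ∈-map⁻ (j ∷_) k∷y∈layer
...   | _ , y∈Gj , refl = here refl , y∈Gj

stack-unique : ∀ {n} {K} {G : ℤ → List (Point n)} →
               Unique K → (∀ k → Unique (G k)) → Unique (stack K G)
stack-unique {K = []} [] uG = []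
stack-unique {K = k ∷ K} {G} (k∉K ∷ uK) uG =
  Unique.++⁺ (Unique.map⁺ ∷-injectiveʳ (uG k)) (stack-unique uK uG) layer-disjoint
  where
  layer-disjoint : ∀ {x} → ¬ (x ∈ map (k ∷_) (G k) × x ∈ stack K G)
  layer-disjoint (x∈layer , x∈rest) with ∈-map⁻ (k ∷_) x∈layer
  ... | _ , _ , refl = All.lookup k∉K (proj₁ (∈-stack⁻ K G x∈rest)) refl

column : ∀ {n} → Point n → List (Point (suc n)) → List ℤ
column y F = map head (filter (λ x → tail x ≟P y) F)

∈-column⁺ : ∀ {n} {j} {y : Point n} {F} → (j ∷ y) ∈ F → j ∈ column y F
∈-column⁺ j∷y∈F = ∈-map⁺ head (∈-filter⁺ (λ x → tail x ≟P _) j∷y∈F refl)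

∈-column⁻ : ∀ {n} (y : Point n) F {j} → j ∈ column y F → (j ∷ y) ∈ F
∈-column⁻ y F j∈column with ∈-map⁻ head j∈column
... | _ ∷ _ , x∈line , refl with ∈-filter⁻ (λ x → tail x ≟P y) {xs = F} x∈line
...   | x∈F , refl = x∈F

line-meets-boundary : ∀ {n} {F : List (Point (suc n))} {k y} →
                      (k ∷ y) ∈ F → ∃ λ j → (j ∷ y) ∈ boundary F
line-meets-boundary {F = F} {k} {y} k∷y∈F = top , ∈-boundary⁺ zero top∷y∈F above-top∉F
  where
  top : ℤ
  top = max k (column y F)
  top∷y∈F : (top ∷ y) ∈ F
  top∷y∈F with argmax-sel id k (column y F)
  ... | inj₁ top≡k = subst (λ j → (j ∷ y) ∈ F) (sym top≡k) k∷y∈F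
  ... | inj₂ top∈column = ∈-column⁻ y F top∈column
  above-top∉F : ((top ∷ y) ⊕ e zero) ∉ F
  above-top∉F above∈F = ℤ.<-irrefl refl (ℤ.suc[i]≤j⇒i<j (All.lookup (xs≤max k (column y F)) suc-top∈column))
    where
    suc-top∈column : ℤ.suc top ∈ column y F
    suc-top∈column = ∈-column⁺ (subst (_∈ F) (∷-⊕-e-zero top y) above∈F)

boundary-slice⊆boundary : ∀ {n} (F : List (Point (suc n))) {k y} →
                          y ∈ boundary (slice k F) → (k ∷ y) ∈ boundary F
boundary-slice⊆boundary F {k} {y} y∈∂slice with ∈-boundary⁻ (slice k F) y∈∂slice
... | y∈slice , y∉E = ∈-filter⁺ (∁? (inE? F)) (∈-slice⁻ k F y∈slice) k∷y∉E
  where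
  k∷y∉E : ¬ InE F (k ∷ y)
  k∷y∉E (_ , k∷y+e∈F) = y∉E (y∈slice , λ j → ∈-slice⁺ (subst (_∈ F) (∷-⊕-e-suc k y j) (k∷y+e∈F (suc j))))

heads : ∀ {n} → List (Point (suc n)) → List ℤ
heads F = deduplicate ℤ._≟_ (map head F)

length≤sum-slices : ∀ {n} {F : List (Point (suc n))} → Unique F →
                    length F ≤ sum (map (λ k → length (slice k F)) (heads F))
length≤sum-slices {F = F} uF = begin
  length F                                    ≤⟨ unique∧⊆⇒length≤ uF F⊆stack ⟩
  length (stack (heads F) (λ k → slice k F))  ≡⟨ length-stack (heads F) (λ k → slice k F) ⟩
  sum (map (λ k → length (slice k F)) (heads F)) ∎
  where
  open ≤-Reasoning
  F⊆stack : F ⊆ stack (heads F) (λ k → slice k F)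
  F⊆stack {k ∷ y} k∷y∈F = ∈-stack⁺ (∈-deduplicate⁺ ℤ._≟_ (∈-map⁺ head k∷y∈F)) (∈-slice⁺ k∷y∈F)

sum-boundary-slices≤ : ∀ {n} {F : List (Point (suc n))} → Unique F →
                       sum (map (λ k → length (boundary (slice k F))) (heads F)) ≤ length (boundary F)
sum-boundary-slices≤ {F = F} uF = begin
  sum (map (λ k → length (boundary (slice k F))) (heads F)) ≡⟨ length-stack (heads F) (λ k → boundary (slice k F)) ⟨
  length (stack (heads F) (λ k → boundary (slice k F)))     ≤⟨ unique∧⊆⇒length≤ stack-unique-boundary stack⊆boundary ⟩
  length (boundary F) ∎
  where
  open ≤-Reasoning
  stack-unique-boundary : Unique (stack (heads F) (λ k → boundary (slice k F)))
  stack-unique-boundary = stack-unique (deduplicate-! ℤ._≟_ (map head F))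
                                       (λ k → Unique.filter⁺ (∁? (inE? _)) (slice-unique k uF))
  stack⊆boundary : stack (heads F) (λ k → boundary (slice k F)) ⊆ boundary F
  stack⊆boundary {k ∷ y} k∷y∈stack =
    boundary-slice⊆boundary F (proj₂ (∈-stack⁻ (heads F) (λ k → boundary (slice k F)) k∷y∈stack))

length-slice≤length-boundary : ∀ {n} {F : List (Point (suc n))} k → Unique F →
                               length (slice k F) ≤ length (boundary F)
length-slice≤length-boundary {F = F} k uF = begin
  length (slice k F)              ≤⟨ unique∧⊆⇒length≤ (slice-unique k uF) slice⊆tails ⟩
  length (map tail (boundary F))  ≡⟨ length-map tail (boundary F) ⟩
  length (boundary F)             ∎
  where
  open ≤-Reasoning
  slice⊆tails : slice k F ⊆ map tail (boundary F)
  slice⊆tails y∈slice with line-meets-boundary (∈-slice⁻ k F y∈slice)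
  ... | _ , top∈∂F = ∈-map⁺ tail top∈∂F

boundary-isoperimetric : ∀ t (F : List (Point (suc t))) → Unique F →
                         length F ^ suc t ≤ length F * length (boundary F) ^ suc t
boundary-isoperimetric zero [] _ = z≤n
boundary-isoperimetric zero F@((_ ∷ []) ∷ _) _ with line-meets-boundary {F = F} (here refl)
... | j , j∈∂F = *-monoʳ-≤ (length F) (^-monoˡ-≤ 1 (unique∧⊆⇒length≤ (All.[] ∷ []) λ { (here refl) → j∈∂F }))
boundary-isoperimetric (suc t) F uF = begin
  N * N ^ suc t                                 ≤⟨ *-monoʳ-≤ N (^-monoˡ-≤ (suc t) (length≤sum-slices uF)) ⟩
  N * sum (map f (heads F)) ^ suc t             ≤⟨ *-monoʳ-≤ N (powBounded-sum B t f b slice-bound (heads F)) ⟩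
  N * (B * sum (map b (heads F)) ^ suc t)       ≤⟨ *-monoʳ-≤ N (*-monoʳ-≤ B (^-monoˡ-≤ (suc t) (sum-boundary-slices≤ uF))) ⟩
  N * (B * B ^ suc t)                           ∎
  where
  open ≤-Reasoning
  N B : ℕ
  N = length F
  B = length (boundary F)
  f b : ℤ → ℕ
  f k = length (slice k F)
  b k = length (boundary (slice k F))
  slice-bound : ∀ k → PowBounded B (suc t) (f k) (b k)
  slice-bound k = ≤-trans (boundary-isoperimetric t (slice k F) (slice-unique k uF))
                          (*-monoˡ-≤ (b k ^ suc t) (length-slice≤length-boundary k uF))

propositionB1 : (t : ℕ) (F : List (Point (suc t))) → Unique F → F ≢ [] →
    (length (E F) ≤ length F) × (length F ^ t ≤ (length F ∸ length (E F)) ^ suc t)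
propositionB1 t [] _ F≢[] = contradiction refl F≢[]
propositionB1 t F@(_ ∷ _) uF _ =
  length-filter (inE? F) F ,
  *-cancelˡ-≤ (length F) (subst (λ B → length F ^ suc t ≤ length F * B ^ suc t) (length-boundary F)
                                (boundary-isoperimetric t F uF))
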